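{- (Lock Replacement) In the Fitch-style calculus for Intuitionistic S4: if $\Gamma,\bullet,\Gamma''\vdash t:A$ is derivable, then $\Gamma,\Gamma',\Gamma''\vdash t:A$ is derivable for any context $\Gamma'$ such that $\Gamma,\Gamma',\Gamma''$ is a well-formed context.
   Context: Types: $A,B ::= p \mid 1 \mid A\times B \mid A\to B \mid \Box A$ ($p$ atoms). Contexts: $\Gamma ::= \cdot \mid \Gamma,x:A \mid \Gamma,\bullet$ (variables distinct; $\bullet$ is a structural symbol called a lock). Typing rules: (var) $\Gamma,x:A,\Gamma'\vdash x:A$ provided $\Gamma'$ contains no lock; (products) $\Gamma\vdash\langle\rangle:1$; from $\Gamma\vdash t:A$, $\Gamma\vdash u:B$ infer $\Gamma\vdash\langle t,u\rangle:A\times B$; from $\Gamma\vdash t:A_1\times A_2$ infer $\Gamma\vdash\pi_i t:A_i$; (functions) from $\Gamma,x:A\vdash t:B$ infer $\Gamma\vdash\lambda x.t:A\to B$; from $\Gamma\vdash t:A\to B$, $\Gamma\vdash u:A$ infer $\Gamma\vdash t\,u:B$; (shut) from $\Gamma,\bullet\vdash t:A$ infer $\Gamma\vdash\mathrm{shut}\,t:\Box A$; (open) from $\Gamma\vdash t:\Box A$ infer $\Gamma,\Gamma'\vdash\mathrm{open}\,t:A$ for any context $\Gamma'$ (with no restriction on locks in $\Gamma'$). Bound variables are taken up to renaming. -}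

module Defs where

open import Data.Nat using (ℕ)
open import Data.Empty using (⊥)
open import Data.Unit using (⊤)
open import Data.Product using (_×_)
open import Data.Sum using (_⊎_)
open import Relation.Binary.PropositionalEquality using (_≡_)
open import Relation.Nullary using (¬_)

Var : Set
Var = ℕ

data Ty : Set where
  atom : ℕ → Ty
  𝟙    : Ty
  _⊗_  : Ty → Ty → Ty
  _⇒_  : Ty → Ty → Ty
  □_   : Ty → Ty

data Ctx : Set where
  ·      : Ctx
  _,_∶_  : Ctx → Var → Ty → Ctx
  _,•    : Ctx → Ctx

infixl 5 _,_∶_ _,• _,,_

_,,_ : Ctx → Ctx → Ctx
Γ ,, ·          = Γ
Γ ,, (Δ , x ∶ A) = (Γ ,, Δ) , x ∶ A
Γ ,, (Δ ,•)     = (Γ ,, Δ) ,•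

LockFree : Ctx → Set
LockFree ·           = ⊤
LockFree (Γ , _ ∶ _) = LockFree Γ
LockFree (Γ ,•)      = ⊥

_∈dom_ : Var → Ctx → Set
x ∈dom ·           = ⊥
x ∈dom (Γ , y ∶ _) = (x ≡ y) ⊎ (x ∈dom Γ)
x ∈dom (Γ ,•)      = x ∈dom Γ

WF : Ctx → Set
WF ·           = ⊤
WF (Γ , x ∶ _) = WF Γ × ¬ (x ∈dom Γ)
WF (Γ ,•)      = WF Γ

data Tm : Set where
  var   : Var → Tm
  ⟨⟩    : Tm
  ⟨_,_⟩ : Tm → Tm → Tm
  π₁ π₂ : Tm → Tm
  ƛ_·_  : Var → Tm → Tm
  _$_   : Tm → Tm → Tm
  shut  : Tm → Tm
  open' : Tm → Tm

infix 3 _⊢_∶_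

data _⊢_∶_ : Ctx → Tm → Ty → Set where
  ⊢var  : ∀ {Γ Γ' x A} → LockFree Γ' → (Γ , x ∶ A) ,, Γ' ⊢ var x ∶ A
  ⊢unit : ∀ {Γ} → Γ ⊢ ⟨⟩ ∶ 𝟙
  ⊢pair : ∀ {Γ t u A B} → Γ ⊢ t ∶ A → Γ ⊢ u ∶ B → Γ ⊢ ⟨ t , u ⟩ ∶ A ⊗ B
  ⊢π₁   : ∀ {Γ t A B} → Γ ⊢ t ∶ A ⊗ B → Γ ⊢ π₁ t ∶ A
  ⊢π₂   : ∀ {Γ t A B} → Γ ⊢ t ∶ A ⊗ B → Γ ⊢ π₂ t ∶ B
  ⊢lam  : ∀ {Γ x t A B} → Γ , x ∶ A ⊢ t ∶ B → Γ ⊢ ƛ x · t ∶ A ⇒ B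
  ⊢app  : ∀ {Γ t u A B} → Γ ⊢ t ∶ A ⇒ B → Γ ⊢ u ∶ A → Γ ⊢ t $ u ∶ B
  ⊢shut : ∀ {Γ t A} → Γ ,• ⊢ t ∶ A → Γ ⊢ shut t ∶ □ A
  ⊢open : ∀ {Γ Γ' t A} → Γ ⊢ t ∶ □ A → Γ ,, Γ' ⊢ open' t ∶ A

-- Induction on the derivation, with the position of the lock kept as an equation
-- Δ ≡ Γ ,• ,, Γ'' (Γ ,• ,, Γ'' is not a constructor pattern).  A variable lookup
-- never crosses the lock, so it lies in Γ'' and is unaffected; an `open` either
-- cuts the context right of the lock (recurse) or discards a suffix containing the
-- lock, and then may just as well discard Γ' in its place.
module Submission where

open import Defs
open import Data.Empty using (⊥; ⊥-elim)
open import Data.Product using (_×_; _,_; ∃-syntax)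
open import Data.Sum using (_⊎_; inj₁; inj₂)
open import Relation.Binary.PropositionalEquality
  using (_≡_; refl; sym; trans; cong; subst)

cast : ∀ {Δ Θ t A} → Δ ≡ Θ → Δ ⊢ t ∶ A → Θ ⊢ t ∶ A
cast {t = t} {A} = subst (λ Θ → Θ ⊢ t ∶ A)

,-injective : ∀ {Γ Δ x y A B} → (Γ , x ∶ A) ≡ (Δ , y ∶ B) → Γ ≡ Δ × x ≡ y × A ≡ B
,-injective refl = refl , refl , refl

,•-injective : ∀ {Γ Δ} → (Γ ,•) ≡ (Δ ,•) → Γ ≡ Δ
,•-injective refl = refl

,≢,• : ∀ {Γ Δ x A} → (Γ , x ∶ A) ≡ (Δ ,•) → ⊥
,≢,• ()

,,-assoc : ∀ Γ Δ Θ → Γ ,, (Δ ,, Θ) ≡ (Γ ,, Δ) ,, Θ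
,,-assoc Γ Δ ·           = refl
,,-assoc Γ Δ (Θ , x ∶ A) = cong (_, x ∶ A) (,,-assoc Γ Δ Θ)
,,-assoc Γ Δ (Θ ,•)      = cong _,• (,,-assoc Γ Δ Θ)

LockFree-,,ˡ : ∀ Γ Δ → LockFree (Γ ,, Δ) → LockFree Γ
LockFree-,,ˡ Γ ·           lf = lf
LockFree-,,ˡ Γ (Δ , _ ∶ _) lf = LockFree-,,ˡ Γ Δ lf

,,-split : ∀ Γ Γ'' Δ Δ' → Δ ,, Δ' ≡ Γ ,, Γ''
  → (∃[ E ] Γ'' ≡ E ,, Δ' × Δ ≡ Γ ,, E)
  ⊎ (∃[ E ] Γ ≡ Δ ,, E × Δ' ≡ E ,, Γ'')
,,-split Γ Γ'' Δ · eq = inj₁ (Γ'' , refl , eq)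
,,-split Γ · Δ Δ'@(_ , _ ∶ _) eq = inj₂ (Δ' , sym eq , refl)
,,-split Γ · Δ Δ'@(_ ,•) eq = inj₂ (Δ' , sym eq , refl)
,,-split Γ (G , _ ∶ _) Δ (D , y ∶ B) eq with ,-injective eq
... | eq' , refl , refl with ,,-split Γ G Δ D eq'
...   | inj₁ (E , p , q) = inj₁ (E , cong (_, y ∶ B) p , q)
...   | inj₂ (E , p , q) = inj₂ (E , p , cong (_, y ∶ B) q)
,,-split Γ (G ,•) Δ (D ,•) eq with ,,-split Γ G Δ D (,•-injective eq)
... | inj₁ (E , p , q) = inj₁ (E , cong _,• p , q)
... | inj₂ (E , p , q) = inj₂ (E , p , cong _,• q)
,,-split Γ (G ,•) Δ (D , _ ∶ _) eq = ⊥-elim (,≢,• eq)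
,,-split Γ (G , _ ∶ _) Δ (D ,•) eq = ⊥-elim (,≢,• (sym eq))

var-right-of-lock : ∀ Γ Γ'' Δ Δ' {x A} → LockFree Δ'
  → (Δ , x ∶ A) ,, Δ' ≡ Γ ,• ,, Γ''
  → ∃[ E ] Γ'' ≡ (E , x ∶ A) ,, Δ'
var-right-of-lock Γ Γ'' Δ Δ' lf eq with ,,-split (Γ ,•) Γ'' (Δ , _ ∶ _) Δ' eq
... | inj₁ ((E , _ ∶ _) , p , q) with ,-injective q
...   | _ , refl , refl = E , p
var-right-of-lock Γ Γ'' Δ Δ' lf eq | inj₁ (· , _ , q)    = ⊥-elim (,≢,• q)
var-right-of-lock Γ Γ'' Δ Δ' lf eq | inj₁ (E ,• , _ , q) = ⊥-elim (,≢,• q)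
var-right-of-lock Γ Γ'' Δ Δ' lf eq | inj₂ (E ,• , _ , refl) = ⊥-elim (LockFree-,,ˡ (E ,•) Γ'' lf)
var-right-of-lock Γ Γ'' Δ Δ' lf eq | inj₂ (· , p , _)         = ⊥-elim (,≢,• (sym p))
var-right-of-lock Γ Γ'' Δ Δ' lf eq | inj₂ (E , _ ∶ _ , p , _) = ⊥-elim (,≢,• (sym p))

data OpenCut (Γ Γ'' Δ Δ' : Ctx) : Set where
  right-of-lock : ∀ E → Γ'' ≡ E ,, Δ' → Δ ≡ Γ ,• ,, E → OpenCut Γ Γ'' Δ Δ'
  at-lock       : Δ ≡ Γ ,• → OpenCut Γ Γ'' Δ Δ'
  left-of-lock  : ∀ E → Γ ≡ Δ ,, E → OpenCut Γ Γ'' Δ Δ'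

openCut : ∀ Γ Γ'' Δ Δ' → Δ ,, Δ' ≡ Γ ,• ,, Γ'' → OpenCut Γ Γ'' Δ Δ'
openCut Γ Γ'' Δ Δ' eq with ,,-split (Γ ,•) Γ'' Δ Δ' eq
... | inj₁ (E , p , q)            = right-of-lock E p q
... | inj₂ (· , p , _)            = at-lock (sym p)
... | inj₂ (E ,• , p , _)         = left-of-lock E (,•-injective p)
... | inj₂ (E , _ ∶ _ , p , _)    = ⊥-elim (,≢,• (sym p))

replace-lock : ∀ {Δ t A} → Δ ⊢ t ∶ A
  → ∀ Γ Γ' Γ'' → Δ ≡ Γ ,• ,, Γ'' → Γ ,, Γ' ,, Γ'' ⊢ t ∶ A
replace-lock (⊢var {Δ} {Δ'} {x} {A} lf) Γ Γ' Γ'' eq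
  with var-right-of-lock Γ Γ'' Δ Δ' lf eq
... | E , refl = cast (sym (,,-assoc (Γ ,, Γ') (E , x ∶ A) Δ')) (⊢var lf)
replace-lock ⊢unit        Γ Γ' Γ'' eq = ⊢unit
replace-lock (⊢pair d e)  Γ Γ' Γ'' eq = ⊢pair (replace-lock d Γ Γ' Γ'' eq) (replace-lock e Γ Γ' Γ'' eq)
replace-lock (⊢π₁ d)      Γ Γ' Γ'' eq = ⊢π₁ (replace-lock d Γ Γ' Γ'' eq)
replace-lock (⊢π₂ d)      Γ Γ' Γ'' eq = ⊢π₂ (replace-lock d Γ Γ' Γ'' eq)
replace-lock (⊢lam {x = x} {A = A} d) Γ Γ' Γ'' eq =
  ⊢lam (replace-lock d Γ Γ' (Γ'' , x ∶ A) (cong (_, x ∶ A) eq))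
replace-lock (⊢app d e)   Γ Γ' Γ'' eq = ⊢app (replace-lock d Γ Γ' Γ'' eq) (replace-lock e Γ Γ' Γ'' eq)
replace-lock (⊢shut d)    Γ Γ' Γ'' eq = ⊢shut (replace-lock d Γ Γ' (Γ'' ,•) (cong _,• eq))
replace-lock (⊢open {Δ} {Δ'} d) Γ Γ' Γ'' eq with openCut Γ Γ'' Δ Δ' eq
... | right-of-lock E refl q =
  cast (sym (,,-assoc (Γ ,, Γ') E Δ')) (⊢open {Γ' = Δ'} (replace-lock d Γ Γ' E q))
... | at-lock q = ⊢open {Γ' = Γ''} (replace-lock d Γ Γ' · q)
... | left-of-lock E refl =
  cast (trans (,,-assoc Δ (E ,, Γ') Γ'') (cong (_,, Γ'') (,,-assoc Δ E Γ')))
       (⊢open {Γ' = E ,, Γ' ,, Γ''} d)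

lemma4 : ∀ {Γ Γ' Γ'' t A}
    → (Γ ,• ,, Γ'') ⊢ t ∶ A
    → WF (Γ ,, Γ' ,, Γ'')
    → (Γ ,, Γ' ,, Γ'') ⊢ t ∶ A
lemma4 {Γ} {Γ'} {Γ''} d _ = replace-lock d Γ Γ' Γ'' refl
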